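{- For every integer $n\ge0$, $$\begin{bmatrix}2n\\ n\end{bmatrix}\frac{1}{(-q;q)_n^2}+\sum_{k=1}^{n}(-1)^kq^{2\binom{k}{2}}\begin{bmatrix}2n\\ n-k\end{bmatrix}\frac{1+q^{2k}}{(-q;q)_{n-k}(-q;q)_{n+k}}=[n=0].$$
   Context: $q$ is an indeterminate; $(a;q)_n=(1-a)(1-qa)\cdots(1-q^{n-1}a)$, $(a;q)_0=1$; $\begin{bmatrix}n\\k\end{bmatrix}=\frac{(q;q)_n}{(q;q)_k(q;q)_{n-k}}$; $[n=0]$ is $1$ if $n=0$ and $0$ otherwise. -}

module Defs where

open import Level using (Level)
open import Data.Nat as ℕ using (ℕ; zero; suc)
open import Data.Nat.Combinatorics using (_C_)
open import Algebra.Bundles using (CommutativeRing)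

-- All q-series objects are interpreted in an arbitrary commutative ring R
-- at an element q (identities of Z[q]-polynomials / rational functions).
module QSeries {c ℓ : Level} (R : CommutativeRing c ℓ) where
  open CommutativeRing R

  pow : Carrier → ℕ → Carrier
  pow x zero    = 1#
  pow x (suc k) = x * pow x k

  sgn : ℕ → Carrier
  sgn k = pow (- 1#) k

  negPoch : Carrier → ℕ → Carrier
  negPoch q zero    = 1#
  negPoch q (suc m) = negPoch q m * (1# + pow q (suc m))

  -- 1/(-q;q)_m, given chosen inverses inv j of (1+q^j)
  invNegPoch : (ℕ → Carrier) → ℕ → Carrier
  invNegPoch inv zero    = 1#
  invNegPoch inv (suc m) = invNegPoch inv m * inv (suc m)

  qbinom : Carrier → ℕ → ℕ → Carrier
  qbinom q zero    zero    = 1#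
  qbinom q zero    (suc k) = 0#
  qbinom q (suc n) zero    = 1#
  qbinom q (suc n) (suc k) = qbinom q n k + pow q (suc k) * qbinom q n (suc k)

  sum1 : (ℕ → Carrier) → ℕ → Carrier
  sum1 f zero    = 0#
  sum1 f (suc n) = sum1 f n + f (suc n)

  isZero : ℕ → Carrier
  isZero zero    = 1#
  isZero (suc n) = 0#

  lhs : Carrier → (ℕ → Carrier) → ℕ → Carrier
  lhs q inv n =
    qbinom q (2 ℕ.* n) n * (invNegPoch inv n * invNegPoch inv n)
    + sum1 (λ k → sgn k * pow q (2 ℕ.* (k C 2)) * qbinom q (2 ℕ.* n) (n ℕ.∸ k)
                  * (1# + pow q (2 ℕ.* k))
                  * (invNegPoch inv (n ℕ.∸ k) * invNegPoch inv (n ℕ.+ k))) n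

{-# OPTIONS --safe #-}
module Submission where

-- With Q = q², the identity (q;q)_m (-q;q)_m = (Q;Q)_m gives
--   [a+b, a]_q (-q;q)_{a+b} = [a+b, a]_Q (-q;q)_a (-q;q)_b,
-- so the left-hand side is T(Q) / (-q;q)_{2n} with
--   T(Q) = [2n, n]_Q + Σ_{k=1}^{n} (-1)^k Q^C(k,2) [2n, n-k]_Q (1 + Q^k).
-- Splitting 1 + Q^k and using [2n, n-k] = [2n, n+k] and C(k,2) + k = C(-k,2),
--   T(Q) = (-1)^n Σ_{j=0}^{2n} (-1)^j Q^C(n-j,2) [2n, j]_Q,
-- which by the q-binomial theorem is (-1)^n Q^C(n,2) (Q^(1-n); Q)_{2n}; for n ≥ 1
-- the product contains the factor 1 - Q^0. Without negative powers of Q this is the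
-- recursion S(M+1, K+1) = S(M, K) (Q^K - 1) for S(M, K) = Σ_j (-1)^j Q^C(K-j,2) [M, j]_Q,
-- i.e. (z;Q)_{M+1} = (1 - z) (zQ;Q)_M.

open import Defs
open import Level using (Level)
open import Algebra.Bundles using (CommutativeRing)
open import Data.Nat as ℕ using (ℕ; zero; suc; _≤_; z≤n; s≤s)
import Data.Nat.Properties as ℕₚ
open import Data.Nat.Combinatorics using (_C_; nCk+nC[k+1]≡[n+1]C[k+1]; nC1≡n)
import Relation.Binary.PropositionalEquality as ≡
open ≡ using (_≡_)
import Relation.Binary.Reasoning.Setoid as SetoidReasoning
import Algebra.Solver.Ring.NaturalCoefficients.Default as NaturalCoefficients
import Algebra.Properties.Ring as RingProperties
import Algebra.Properties.CommutativeSemigroup as CommutativeSemigroupProperties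

[1+k]C2≡k+kC2 : ∀ k → suc k C 2 ≡ k ℕ.+ k C 2
[1+k]C2≡k+kC2 k =
  ≡.trans (≡.sym (nCk+nC[k+1]≡[n+1]C[k+1] k 1)) (≡.cong (ℕ._+ k C 2) (nC1≡n k))

-- diffC2 K j is the binomial coefficient C(K - j, 2) of the integer K - j,
-- i.e. C(j - K + 1, 2) when K < j.
diffC2 : ℕ → ℕ → ℕ
diffC2 K       zero    = K C 2
diffC2 zero    (suc j) = suc (suc j) C 2
diffC2 (suc K) (suc j) = diffC2 K j

diffC2-+ˡ : ∀ j k → diffC2 (j ℕ.+ k) j ≡ k C 2
diffC2-+ˡ zero    k = ≡.refl
diffC2-+ˡ (suc j) k = diffC2-+ˡ j k

diffC2-+ʳ : ∀ j k → diffC2 j (j ℕ.+ k) ≡ suc k C 2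
diffC2-+ʳ zero    zero    = ≡.refl
diffC2-+ʳ zero    (suc k) = ≡.refl
diffC2-+ʳ (suc j) k       = diffC2-+ʳ j k

diffC2-diag : ∀ n → diffC2 n n ≡ 0
diffC2-diag zero    = ≡.refl
diffC2-diag (suc n) = diffC2-diag n

diffC2-suc : ∀ K j → diffC2 (suc K) j ℕ.+ j ≡ diffC2 K j ℕ.+ K
diffC2-suc K zero = begin
  suc K C 2 ℕ.+ 0  ≡⟨ ℕₚ.+-identityʳ _ ⟩
  suc K C 2        ≡⟨ [1+k]C2≡k+kC2 K ⟩
  K ℕ.+ K C 2      ≡⟨ ℕₚ.+-comm K _ ⟩
  K C 2 ℕ.+ K      ∎
  where open ≡.≡-Reasoning
diffC2-suc zero (suc j) = begin
  diffC2 0 j ℕ.+ suc j     ≡⟨ ≡.cong (ℕ._+ suc j) (diffC2-+ʳ 0 j) ⟩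
  suc j C 2 ℕ.+ suc j      ≡⟨ ℕₚ.+-comm _ (suc j) ⟩
  suc j ℕ.+ suc j C 2      ≡⟨ [1+k]C2≡k+kC2 (suc j) ⟨
  suc (suc j) C 2          ≡⟨ ℕₚ.+-identityʳ _ ⟨
  suc (suc j) C 2 ℕ.+ 0    ∎
  where open ≡.≡-Reasoning
diffC2-suc (suc K) (suc j) = begin
  diffC2 (suc K) j ℕ.+ suc j    ≡⟨ ℕₚ.+-suc _ j ⟩
  suc (diffC2 (suc K) j ℕ.+ j)  ≡⟨ ≡.cong suc (diffC2-suc K j) ⟩
  suc (diffC2 K j ℕ.+ K)        ≡⟨ ℕₚ.+-suc _ K ⟨
  diffC2 K j ℕ.+ suc K          ∎
  where open ≡.≡-Reasoning

[n∸k]+[n+k]≡2n : ∀ {n k} → k ≤ n → (n ℕ.∸ k) ℕ.+ (n ℕ.+ k) ≡ 2 ℕ.* n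
[n∸k]+[n+k]≡2n {n} {k} k≤n = begin
  (n ℕ.∸ k) ℕ.+ (n ℕ.+ k)  ≡⟨ ≡.cong ((n ℕ.∸ k) ℕ.+_) (ℕₚ.+-comm n k) ⟩
  (n ℕ.∸ k) ℕ.+ (k ℕ.+ n)  ≡⟨ ℕₚ.+-assoc (n ℕ.∸ k) k n ⟨
  (n ℕ.∸ k) ℕ.+ k ℕ.+ n    ≡⟨ ≡.cong (ℕ._+ n) (ℕₚ.m∸n+n≡m k≤n) ⟩
  n ℕ.+ n                  ≡⟨ ≡.cong (n ℕ.+_) (ℕₚ.+-identityʳ n) ⟨
  2 ℕ.* n                  ∎
  where open ≡.≡-Reasoning

module _ {c ℓ : Level} (R : CommutativeRing c ℓ) where
  open CommutativeRing R hiding (zero)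
  open QSeries R
  open SetoidReasoning setoid
  open NaturalCoefficients commutativeSemiring using (solve; _:=_; _:+_; _:*_; con)
  open RingProperties ring using (-1*x≈-x; -‿involutive)
  open CommutativeSemigroupProperties +-commutativeSemigroup
    using (x∙yz≈y∙xz) renaming (interchange to +-interchange)
  open import Algebra.Properties.CommutativeSemiring.Exp commutativeSemiring
    using (_^_; ^-homo-*; ^-distrib-*)

  pow≡^ : ∀ x k → pow x k ≡ x ^ k
  pow≡^ x zero    = ≡.refl
  pow≡^ x (suc k) = ≡.cong (x *_) (pow≡^ x k)

  pow-+ : ∀ x a b → pow x (a ℕ.+ b) ≈ pow x a * pow x b
  pow-+ x a b rewrite pow≡^ x (a ℕ.+ b) | pow≡^ x a | pow≡^ x b = ^-homo-* x a b

  pow-distrib-* : ∀ x y k → pow (x * y) k ≈ pow x k * pow y k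
  pow-distrib-* x y k rewrite pow≡^ (x * y) k | pow≡^ x k | pow≡^ y k = ^-distrib-* x y k

  pow-2* : ∀ x k → pow x (2 ℕ.* k) ≈ pow (x * x) k
  pow-2* x k = begin
    pow x (k ℕ.+ (k ℕ.+ 0))  ≈⟨ reflexive (≡.cong (λ e → pow x (k ℕ.+ e)) (ℕₚ.+-identityʳ k)) ⟩
    pow x (k ℕ.+ k)          ≈⟨ pow-+ x k k ⟩
    pow x k * pow x k        ≈⟨ pow-distrib-* x x k ⟨
    pow (x * x) k            ∎

  sgn-+ : ∀ a b → sgn (a ℕ.+ b) ≈ sgn a * sgn b
  sgn-+ = pow-+ (- 1#)

  sgn-square : ∀ k → sgn k * sgn k ≈ 1#
  sgn-square zero    = *-identityʳ 1#
  sgn-square (suc k) = begin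
    (- 1# * sgn k) * (- 1# * sgn k)
      ≈⟨ solve 2 (λ m s → (m :* s) :* (m :* s) := (m :* m) :* (s :* s)) refl (- 1#) (sgn k) ⟩
    (- 1# * - 1#) * (sgn k * sgn k)  ≈⟨ *-cong (trans (-1*x≈-x (- 1#)) (-‿involutive 1#)) (sgn-square k) ⟩
    1# * 1#                          ≈⟨ *-identityʳ 1# ⟩
    1#                               ∎

  sgn-∸ : ∀ {n k} → k ≤ n → sgn (n ℕ.∸ k) ≈ sgn n * sgn k
  sgn-∸ {n} {k} k≤n = begin
    sgn (n ℕ.∸ k)                      ≈⟨ *-identityʳ _ ⟨
    sgn (n ℕ.∸ k) * 1#                 ≈⟨ *-congˡ (sgn-square k) ⟨
    sgn (n ℕ.∸ k) * (sgn k * sgn k)    ≈⟨ *-assoc _ _ _ ⟨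
    sgn (n ℕ.∸ k) * sgn k * sgn k      ≈⟨ *-congʳ (sgn-+ (n ℕ.∸ k) k) ⟨
    sgn (n ℕ.∸ k ℕ.+ k) * sgn k        ≈⟨ *-congʳ (reflexive (≡.cong sgn (ℕₚ.m∸n+n≡m k≤n))) ⟩
    sgn n * sgn k                      ∎

  sum0 : (ℕ → Carrier) → ℕ → Carrier
  sum0 f zero    = f zero
  sum0 f (suc n) = sum0 f n + f (suc n)

  sum0-cong : ∀ {f g} n → (∀ j → j ≤ n → f j ≈ g j) → sum0 f n ≈ sum0 g n
  sum0-cong zero    f≈g = f≈g 0 z≤n
  sum0-cong (suc n) f≈g =
    +-cong (sum0-cong n (λ j j≤n → f≈g j (ℕₚ.m≤n⇒m≤1+n j≤n))) (f≈g (suc n) ℕₚ.≤-refl)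

  sum1-cong : ∀ {f g} n → (∀ k → 1 ≤ k → k ≤ n → f k ≈ g k) → sum1 f n ≈ sum1 g n
  sum1-cong zero    f≈g = refl
  sum1-cong (suc n) f≈g =
    +-cong (sum1-cong n (λ k 1≤k k≤n → f≈g k 1≤k (ℕₚ.m≤n⇒m≤1+n k≤n)))
           (f≈g (suc n) (s≤s z≤n) ℕₚ.≤-refl)

  sum0-distrib-+ : ∀ f g n → sum0 (λ j → f j + g j) n ≈ sum0 f n + sum0 g n
  sum0-distrib-+ f g zero    = refl
  sum0-distrib-+ f g (suc n) = trans (+-congʳ (sum0-distrib-+ f g n)) (+-interchange _ _ _ _)

  sum1-distrib-+ : ∀ f g n → sum1 (λ k → f k + g k) n ≈ sum1 f n + sum1 g n
  sum1-distrib-+ f g zero    = sym (+-identityʳ 0#)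
  sum1-distrib-+ f g (suc n) = trans (+-congʳ (sum1-distrib-+ f g n)) (+-interchange _ _ _ _)

  *-distribʳ-sum0 : ∀ x f n → sum0 f n * x ≈ sum0 (λ j → f j * x) n
  *-distribʳ-sum0 x f zero    = refl
  *-distribʳ-sum0 x f (suc n) = trans (distribʳ x _ _) (+-congʳ (*-distribʳ-sum0 x f n))

  *-distribʳ-sum1 : ∀ x f n → sum1 f n * x ≈ sum1 (λ k → f k * x) n
  *-distribʳ-sum1 x f zero    = zeroˡ x
  *-distribʳ-sum1 x f (suc n) = trans (distribʳ x _ _) (+-congʳ (*-distribʳ-sum1 x f n))

  sum0-shift : ∀ f n → sum0 f (suc n) ≈ f 0 + sum0 (λ j → f (suc j)) n
  sum0-shift f zero    = refl
  sum0-shift f (suc n) = trans (+-congʳ (sum0-shift f n)) (+-assoc _ _ _)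

  sum0≈head+sum1 : ∀ f n → sum0 f n ≈ f 0 + sum1 f n
  sum0≈head+sum1 f zero    = sym (+-identityʳ _)
  sum0≈head+sum1 f (suc n) = trans (+-congʳ (sum0≈head+sum1 f n)) (+-assoc _ _ _)

  sum0-split : ∀ f m n → sum0 f (m ℕ.+ n) ≈ sum0 f m + sum1 (λ k → f (m ℕ.+ k)) n
  sum0-split f m zero    = trans (reflexive (≡.cong (sum0 f) (ℕₚ.+-identityʳ m))) (sym (+-identityʳ _))
  sum0-split f m (suc n) = begin
    sum0 f (m ℕ.+ suc n)                       ≡⟨ ≡.cong (sum0 f) (ℕₚ.+-suc m n) ⟩
    sum0 f (m ℕ.+ n) + f (suc (m ℕ.+ n))       ≈⟨ +-congʳ (sum0-split f m n) ⟩
    sum0 f m + sum1 g n + f (suc (m ℕ.+ n))    ≈⟨ +-assoc _ _ _ ⟩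
    sum0 f m + (sum1 g n + f (suc (m ℕ.+ n)))  ≡⟨ ≡.cong (λ i → sum0 f m + (sum1 g n + f i)) (ℕₚ.+-suc m n) ⟨
    sum0 f m + (sum1 g n + f (m ℕ.+ suc n))    ∎
    where g = λ k → f (m ℕ.+ k)

  sum0-reverse : ∀ f n → sum0 f n ≈ sum0 (λ j → f (n ℕ.∸ j)) n
  sum0-reverse f zero    = refl
  sum0-reverse f (suc n) = begin
    sum0 f n + f (suc n)                                  ≈⟨ +-congʳ (sum0-reverse f n) ⟩
    sum0 (λ j → f (n ℕ.∸ j)) n + f (suc n)                ≈⟨ +-comm _ _ ⟩
    f (suc n) + sum0 (λ j → f (n ℕ.∸ j)) n                ≈⟨ sum0-shift (λ j → f (suc n ℕ.∸ j)) n ⟨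
    sum0 (λ j → f (suc n ℕ.∸ j)) (suc n)                  ∎

  sum0-fold : ∀ f n → sum0 f (n ℕ.+ n) ≈ f n + sum1 (λ k → f (n ℕ.∸ k) + f (n ℕ.+ k)) n
  sum0-fold f n = begin
    sum0 f (n ℕ.+ n)                                                  ≈⟨ sum0-split f n n ⟩
    sum0 f n + sum1 (λ k → f (n ℕ.+ k)) n                             ≈⟨ +-congʳ (sum0-reverse f n) ⟩
    sum0 (λ j → f (n ℕ.∸ j)) n + sum1 (λ k → f (n ℕ.+ k)) n           ≈⟨ +-congʳ (sum0≈head+sum1 _ n) ⟩
    f n + sum1 (λ k → f (n ℕ.∸ k)) n + sum1 (λ k → f (n ℕ.+ k)) n     ≈⟨ +-assoc _ _ _ ⟩
    f n + (sum1 (λ k → f (n ℕ.∸ k)) n + sum1 (λ k → f (n ℕ.+ k)) n)   ≈⟨ +-congˡ (sum1-distrib-+ _ _ n) ⟨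
    f n + sum1 (λ k → f (n ℕ.∸ k) + f (n ℕ.+ k)) n                    ∎

  qbinom[M,0]≈1 : ∀ x M → qbinom x M 0 ≈ 1#
  qbinom[M,0]≈1 x zero    = refl
  qbinom[M,0]≈1 x (suc M) = refl

  M<k⇒qbinom[M,k]≈0 : ∀ x {M k} → M ℕ.< k → qbinom x M k ≈ 0#
  M<k⇒qbinom[M,k]≈0 x {zero}  {suc k} _         = refl
  M<k⇒qbinom[M,k]≈0 x {suc M} {suc k} (s≤s M<k) = begin
    qbinom x M k + pow x (suc k) * qbinom x M (suc k)
      ≈⟨ +-cong (M<k⇒qbinom[M,k]≈0 x M<k) (*-congˡ (M<k⇒qbinom[M,k]≈0 x (ℕₚ.m<n⇒m<1+n M<k))) ⟩
    0# + pow x (suc k) * 0#                            ≈⟨ +-identityˡ _ ⟩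
    pow x (suc k) * 0#                                 ≈⟨ zeroʳ _ ⟩
    0#                                                 ∎

  qbinom[M,M]≈1 : ∀ x M → qbinom x M M ≈ 1#
  qbinom[M,M]≈1 x zero    = refl
  qbinom[M,M]≈1 x (suc M) = begin
    qbinom x M M + pow x (suc M) * qbinom x M (suc M)
      ≈⟨ +-cong (qbinom[M,M]≈1 x M) (*-congˡ (M<k⇒qbinom[M,k]≈0 x (ℕₚ.n<1+n M))) ⟩
    1# + pow x (suc M) * 0#                            ≈⟨ +-congˡ (zeroʳ _) ⟩
    1# + 0#                                            ≈⟨ +-identityʳ 1# ⟩
    1#                                                 ∎

  -- qbinom₂ x a b = [a+b, a]_x. Indexed by the two parts a and b, both q-Pascal rules
  -- become structural recursions, which makes symmetry provable by induction.
  qbinom₂ : Carrier → ℕ → ℕ → Carrier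
  qbinom₂ x zero    b       = 1#
  qbinom₂ x (suc a) zero    = 1#
  qbinom₂ x (suc a) (suc b) = qbinom₂ x a (suc b) + pow x (suc a) * qbinom₂ x (suc a) b

  qbinom≈qbinom₂ : ∀ x a b → qbinom x (a ℕ.+ b) a ≈ qbinom₂ x a b
  qbinom≈qbinom₂ x zero    b       = qbinom[M,0]≈1 x b
  qbinom≈qbinom₂ x (suc a) zero    =
    trans (reflexive (≡.cong (λ M → qbinom x M (suc a)) (ℕₚ.+-identityʳ (suc a)))) (qbinom[M,M]≈1 x (suc a))
  qbinom≈qbinom₂ x (suc a) (suc b) = +-cong (qbinom≈qbinom₂ x a (suc b)) (*-congˡ (begin
    qbinom x (a ℕ.+ suc b) (suc a)    ≡⟨ ≡.cong (λ M → qbinom x M (suc a)) (ℕₚ.+-suc a b) ⟩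
    qbinom x (suc a ℕ.+ b) (suc a)    ≈⟨ qbinom≈qbinom₂ x (suc a) b ⟩
    qbinom₂ x (suc a) b               ∎))

  qbinom₂-pascal′ : ∀ x a b →
    qbinom₂ x (suc a) (suc b) ≈ pow x (suc b) * qbinom₂ x a (suc b) + qbinom₂ x (suc a) b
  qbinom₂-pascal′ x zero    zero    = +-comm _ _
  qbinom₂-pascal′ x zero    (suc b) = begin
    1# + x₁ * qbinom₂ x 1 (suc b)
      ≈⟨ +-congˡ (*-congˡ (qbinom₂-pascal′ x zero b)) ⟩
    1# + x₁ * (pow x (suc b) * 1# + qbinom₂ x 1 b)
      ≈⟨ solve 3 (λ x p B → con 1 :+ (x :* con 1) :* (p :* con 1 :+ B)
                         := (x :* p) :* con 1 :+ (con 1 :+ (x :* con 1) :* B))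
                 refl x (pow x (suc b)) (qbinom₂ x 1 b) ⟩
    pow x (suc (suc b)) * 1# + (1# + x₁ * qbinom₂ x 1 b)
      ∎
    where x₁ = pow x 1
  qbinom₂-pascal′ x (suc a) zero    = begin
    qbinom₂ x (suc a) 1 + pow x (suc (suc a)) * 1#
      ≈⟨ +-congʳ (qbinom₂-pascal′ x a zero) ⟩
    x₁ * qbinom₂ x a 1 + 1# + pow x (suc (suc a)) * 1#
      ≈⟨ solve 3 (λ x p B → (x :* con 1) :* B :+ con 1 :+ (x :* p) :* con 1
                         := (x :* con 1) :* (B :+ p :* con 1) :+ con 1)
                 refl x (pow x (suc a)) (qbinom₂ x a 1) ⟩
    x₁ * qbinom₂ x (suc a) 1 + 1#
      ∎
    where x₁ = pow x 1
  qbinom₂-pascal′ x (suc a) (suc b) = begin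
    qbinom₂ x (suc a) (suc (suc b)) + pow x (suc (suc a)) * qbinom₂ x (suc (suc a)) (suc b)
      ≈⟨ +-cong (qbinom₂-pascal′ x a (suc b)) (*-congˡ (qbinom₂-pascal′ x (suc a) b)) ⟩
    (x * y * A + B) + x * u * (y * B + C)
      ≈⟨ solve 6 (λ x u y A B C → (x :* y :* A :+ B) :+ x :* u :* (y :* B :+ C)
                               := x :* y :* (A :+ u :* B) :+ (B :+ x :* u :* C))
                 refl x u y A B C ⟩
    x * y * (A + u * B) + (B + x * u * C)
      ∎
    where
      u = pow x (suc a)
      y = pow x (suc b)
      A = qbinom₂ x a (suc (suc b))
      B = qbinom₂ x (suc a) (suc b)
      C = qbinom₂ x (suc (suc a)) b

  qbinom₂-comm : ∀ x a b → qbinom₂ x a b ≈ qbinom₂ x b a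
  qbinom₂-comm x zero    zero    = refl
  qbinom₂-comm x zero    (suc b) = refl
  qbinom₂-comm x (suc a) zero    = refl
  qbinom₂-comm x (suc a) (suc b) = begin
    qbinom₂ x a (suc b) + pow x (suc a) * qbinom₂ x (suc a) b
      ≈⟨ +-cong (qbinom₂-comm x a (suc b)) (*-congˡ (qbinom₂-comm x (suc a) b)) ⟩
    qbinom₂ x (suc b) a + pow x (suc a) * qbinom₂ x b (suc a)  ≈⟨ +-comm _ _ ⟩
    pow x (suc a) * qbinom₂ x b (suc a) + qbinom₂ x (suc b) a  ≈⟨ qbinom₂-pascal′ x b a ⟨
    qbinom₂ x (suc b) (suc a)                                  ∎

  qbinom₂-negPoch : ∀ q a b →
    qbinom₂ q a b * negPoch q (a ℕ.+ b) ≈ qbinom₂ (q * q) a b * (negPoch q a * negPoch q b)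
  qbinom₂-negPoch q zero    b       = *-congˡ (sym (*-identityˡ _))
  qbinom₂-negPoch q (suc a) zero    =
    *-congˡ (trans (reflexive (≡.cong (negPoch q) (ℕₚ.+-identityʳ (suc a)))) (sym (*-identityʳ _)))
  qbinom₂-negPoch q (suc a) (suc b) = begin
    (X + u * Y) * (P * (1# + pow q (suc a ℕ.+ suc b)))
      ≈⟨ *-congˡ (*-congˡ (+-congˡ (pow-+ q (suc a) (suc b)))) ⟩
    (X + u * Y) * (P * (1# + u * v))
      ≈⟨ solve 5 (λ X Y u v P → (X :+ u :* Y) :* (P :* (con 1 :+ u :* v))
                             := (X :+ u :* u :* v :* Y :+ u :* (v :* X :+ Y)) :* P)
                 refl X Y u v P ⟩
    (X + u * u * v * Y + u * (v * X + Y)) * P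
      ≈⟨ *-congʳ (+-congˡ (*-congˡ (qbinom₂-pascal′ q a b))) ⟨
    (X + u * u * v * Y + u * (X + u * Y)) * P
      ≈⟨ solve 5 (λ X Y u v P → (X :+ u :* u :* v :* Y :+ u :* (X :+ u :* Y)) :* P
                             := (con 1 :+ u) :* (X :* P) :+ u :* u :* (con 1 :+ v) :* (Y :* P))
                 refl X Y u v P ⟩
    (1# + u) * (X * P) + u * u * (1# + v) * (Y * P)
      ≈⟨ +-cong (*-congˡ (qbinom₂-negPoch q a (suc b))) (*-congˡ Y-negPoch) ⟩
    (1# + u) * (X′ * (Pa * (Pb * (1# + v)))) + u * u * (1# + v) * (Y′ * (Pa * (1# + u) * Pb))
      ≈⟨ solve 6 (λ X′ Y′ u v Pa Pb →
                   (con 1 :+ u) :* (X′ :* (Pa :* (Pb :* (con 1 :+ v))))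
                     :+ u :* u :* (con 1 :+ v) :* (Y′ :* (Pa :* (con 1 :+ u) :* Pb))
                := (X′ :+ u :* u :* Y′) :* (Pa :* (con 1 :+ u) :* (Pb :* (con 1 :+ v))))
                 refl X′ Y′ u v Pa Pb ⟩
    (X′ + u * u * Y′) * (Pa * (1# + u) * (Pb * (1# + v)))
      ≈⟨ *-congʳ (+-congˡ (*-congʳ (pow-distrib-* q q (suc a)))) ⟨
    (X′ + pow (q * q) (suc a) * Y′) * (Pa * (1# + u) * (Pb * (1# + v)))
      ∎
    where
      u = pow q (suc a)
      v = pow q (suc b)
      X = qbinom₂ q a (suc b)
      Y = qbinom₂ q (suc a) b
      X′ = qbinom₂ (q * q) a (suc b)
      Y′ = qbinom₂ (q * q) (suc a) b
      P = negPoch q (a ℕ.+ suc b)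
      Pa = negPoch q a
      Pb = negPoch q b
      Y-negPoch : Y * P ≈ Y′ * (Pa * (1# + u) * Pb)
      Y-negPoch = trans (*-congˡ (reflexive (≡.cong (negPoch q) (ℕₚ.+-suc a b)))) (qbinom₂-negPoch q (suc a) b)

  qbinom-sym : ∀ x {a b M} → a ℕ.+ b ≡ M → qbinom x M b ≈ qbinom x M a
  qbinom-sym x {a} {b} ≡.refl = begin
    qbinom x (a ℕ.+ b) b   ≡⟨ ≡.cong (λ M → qbinom x M b) (ℕₚ.+-comm a b) ⟩
    qbinom x (b ℕ.+ a) b   ≈⟨ qbinom≈qbinom₂ x b a ⟩
    qbinom₂ x b a          ≈⟨ qbinom₂-comm x b a ⟩
    qbinom₂ x a b          ≈⟨ qbinom≈qbinom₂ x a b ⟨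
    qbinom x (a ℕ.+ b) a   ∎

  qbinom-negPoch : ∀ q a b →
    qbinom q (a ℕ.+ b) a * negPoch q (a ℕ.+ b) ≈ qbinom (q * q) (a ℕ.+ b) a * (negPoch q a * negPoch q b)
  qbinom-negPoch q a b = begin
    qbinom q (a ℕ.+ b) a * negPoch q (a ℕ.+ b)             ≈⟨ *-congʳ (qbinom≈qbinom₂ q a b) ⟩
    qbinom₂ q a b * negPoch q (a ℕ.+ b)                    ≈⟨ qbinom₂-negPoch q a b ⟩
    qbinom₂ (q * q) a b * (negPoch q a * negPoch q b)      ≈⟨ *-congʳ (qbinom≈qbinom₂ (q * q) a b) ⟨
    qbinom (q * q) (a ℕ.+ b) a * (negPoch q a * negPoch q b) ∎

  altTerm : Carrier → ℕ → ℕ → ℕ → Carrier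
  altTerm x M K j = sgn j * pow x (diffC2 K j) * qbinom x M j

  altSum : Carrier → ℕ → ℕ → Carrier
  altSum x M K = sum0 (altTerm x M K) M

  altTerm-zero : ∀ x M K → altTerm x (suc M) (suc K) 0 ≈ altTerm x M K 0 * pow x K
  altTerm-zero x M K = begin
    1# * pow x (suc K C 2) * 1#
      ≡⟨ ≡.cong (λ e → 1# * pow x e * 1#) ([1+k]C2≡k+kC2 K) ⟩
    1# * pow x (K ℕ.+ K C 2) * 1#
      ≈⟨ *-cong (*-congˡ (pow-+ x K (K C 2))) (sym (qbinom[M,0]≈1 x M)) ⟩
    1# * (pow x K * pow x (K C 2)) * qbinom x M 0
      ≈⟨ solve 3 (λ p e b → con 1 :* (p :* e) :* b := con 1 :* e :* b :* p)
                 refl (pow x K) (pow x (K C 2)) (qbinom x M 0) ⟩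
    1# * pow x (K C 2) * qbinom x M 0 * pow x K
      ∎

  altTerm-suc : ∀ x M K j →
    altTerm x (suc M) (suc K) (suc j) ≈ altTerm x M K j * - 1# + altTerm x M K (suc j) * pow x K
  altTerm-suc x M K j = begin
    - 1# * sgn j * pow x (diffC2 K j) * (qbinom x M j + pow x (suc j) * qbinom x M (suc j))
      ≈⟨ solve 6 (λ m s p b u b′ → m :* s :* p :* (b :+ u :* b′) := s :* p :* b :* m :+ m :* s :* (p :* u) :* b′)
                 refl (- 1#) (sgn j) (pow x (diffC2 K j)) (qbinom x M j) (pow x (suc j)) (qbinom x M (suc j)) ⟩
    altTerm x M K j * - 1# + sgn (suc j) * (pow x (diffC2 K j) * pow x (suc j)) * qbinom x M (suc j)
      ≈⟨ +-congˡ (*-congʳ (*-congˡ exponents)) ⟩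
    altTerm x M K j * - 1# + sgn (suc j) * (pow x (diffC2 K (suc j)) * pow x K) * qbinom x M (suc j)
      ≈⟨ +-congˡ (solve 4 (λ s p w b → s :* (p :* w) :* b := s :* p :* b :* w)
                          refl (sgn (suc j)) (pow x (diffC2 K (suc j))) (pow x K) (qbinom x M (suc j))) ⟩
    altTerm x M K j * - 1# + altTerm x M K (suc j) * pow x K
      ∎
    where
      exponents : pow x (diffC2 K j) * pow x (suc j) ≈ pow x (diffC2 K (suc j)) * pow x K
      exponents = begin
        pow x (diffC2 K j) * pow x (suc j)      ≈⟨ pow-+ x (diffC2 K j) (suc j) ⟨
        pow x (diffC2 K j ℕ.+ suc j)            ≡⟨ ≡.cong (pow x) (diffC2-suc K (suc j)) ⟩
        pow x (diffC2 K (suc j) ℕ.+ K)          ≈⟨ pow-+ x (diffC2 K (suc j)) K ⟩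
        pow x (diffC2 K (suc j)) * pow x K      ∎

  altSum-suc : ∀ x M K → altSum x (suc M) (suc K) ≈ altSum x M K * (- 1# + pow x K)
  altSum-suc x M K = begin
    sum0 t′ (suc M)
      ≈⟨ sum0-shift t′ M ⟩
    t′ 0 + sum0 (λ j → t′ (suc j)) M
      ≈⟨ +-cong (altTerm-zero x M K) (sum0-cong M (λ j _ → altTerm-suc x M K j)) ⟩
    t 0 * w + sum0 (λ j → t j * - 1# + t (suc j) * w) M
      ≈⟨ +-congˡ (sum0-distrib-+ _ _ M) ⟩
    t 0 * w + (sum0 (λ j → t j * - 1#) M + sum0 (λ j → t (suc j) * w) M)
      ≈⟨ x∙yz≈y∙xz _ _ _ ⟩
    sum0 (λ j → t j * - 1#) M + (t 0 * w + sum0 (λ j → t (suc j) * w) M)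
      ≈⟨ +-congˡ (sum0-shift (λ j → t j * w) M) ⟨
    sum0 (λ j → t j * - 1#) M + sum0 (λ j → t j * w) (suc M)
      ≈⟨ +-cong (*-distribʳ-sum0 (- 1#) t M) (*-distribʳ-sum0 w t (suc M)) ⟨
    altSum x M K * - 1# + sum0 t (suc M) * w
      ≈⟨ +-congˡ (*-congʳ top-vanishes) ⟩
    altSum x M K * - 1# + altSum x M K * w
      ≈⟨ distribˡ _ _ _ ⟨
    altSum x M K * (- 1# + w)
      ∎
    where
      t = altTerm x M K
      t′ = altTerm x (suc M) (suc K)
      w = pow x K
      top-vanishes : sum0 t (suc M) ≈ altSum x M K
      top-vanishes = begin
        altSum x M K + sgn (suc M) * pow x (diffC2 K (suc M)) * qbinom x M (suc M)
          ≈⟨ +-congˡ (*-congˡ (M<k⇒qbinom[M,k]≈0 x (ℕₚ.n<1+n M))) ⟩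
        altSum x M K + sgn (suc M) * pow x (diffC2 K (suc M)) * 0#
          ≈⟨ +-congˡ (zeroʳ _) ⟩
        altSum x M K + 0#
          ≈⟨ +-identityʳ _ ⟩
        altSum x M K
          ∎

  altSum-vanishes : ∀ x {M K} → K ≤ M → altSum x (suc M) (suc K) ≈ 0#
  altSum-vanishes x {M} {zero} _ = begin
    altSum x (suc M) 1            ≈⟨ altSum-suc x M 0 ⟩
    altSum x M 0 * (- 1# + 1#)    ≈⟨ *-congˡ (-‿inverseˡ 1#) ⟩
    altSum x M 0 * 0#             ≈⟨ zeroʳ _ ⟩
    0#                            ∎
  altSum-vanishes x {suc M} {suc K} (s≤s K≤M) = begin
    altSum x (suc (suc M)) (suc (suc K))               ≈⟨ altSum-suc x (suc M) (suc K) ⟩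
    altSum x (suc M) (suc K) * (- 1# + pow x (suc K))  ≈⟨ *-congʳ (altSum-vanishes x K≤M) ⟩
    0# * (- 1# + pow x (suc K))                        ≈⟨ zeroˡ _ ⟩
    0#                                                 ∎

  centralTerm : Carrier → ℕ → ℕ → Carrier
  centralTerm x n k = sgn k * pow x (k C 2) * qbinom x (2 ℕ.* n) (n ℕ.∸ k) * (1# + pow x k)

  centralSum : Carrier → ℕ → Carrier
  centralSum x n = qbinom x (2 ℕ.* n) n + sum1 (centralTerm x n) n

  altTerm-pair : ∀ x {n k} → k ≤ n →
    altTerm x (2 ℕ.* n) n (n ℕ.∸ k) + altTerm x (2 ℕ.* n) n (n ℕ.+ k) ≈ centralTerm x n k * sgn n
  altTerm-pair x {n} {k} k≤n = begin
    sgn (n ℕ.∸ k) * pow x (diffC2 n (n ℕ.∸ k)) * β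
      + sgn (n ℕ.+ k) * pow x (diffC2 n (n ℕ.+ k)) * qbinom x (2 ℕ.* n) (n ℕ.+ k)
      ≈⟨ +-cong (*-congʳ (*-cong (sgn-∸ k≤n) (reflexive (≡.cong (pow x) lower-exponent))))
                (*-cong (*-cong (sgn-+ n k) upper-power) (qbinom-sym x ([n∸k]+[n+k]≡2n k≤n))) ⟩
    sgn n * sgn k * pow x (k C 2) * β + sgn n * sgn k * (pow x k * pow x (k C 2)) * β
      ≈⟨ solve 5 (λ s s′ p e b → s :* s′ :* e :* b :+ s :* s′ :* (p :* e) :* b
                              := s′ :* e :* b :* (con 1 :+ p) :* s)
                 refl (sgn n) (sgn k) (pow x k) (pow x (k C 2)) β ⟩
    centralTerm x n k * sgn n
      ∎
    where
      β = qbinom x (2 ℕ.* n) (n ℕ.∸ k)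
      lower-exponent : diffC2 n (n ℕ.∸ k) ≡ k C 2
      lower-exponent =
        ≡.trans (≡.cong (λ m → diffC2 m (n ℕ.∸ k)) (≡.sym (ℕₚ.m∸n+n≡m k≤n))) (diffC2-+ˡ (n ℕ.∸ k) k)
      upper-power : pow x (diffC2 n (n ℕ.+ k)) ≈ pow x k * pow x (k C 2)
      upper-power =
        trans (reflexive (≡.cong (pow x) (≡.trans (diffC2-+ʳ n k) ([1+k]C2≡k+kC2 k)))) (pow-+ x k (k C 2))

  altSum≈centralSum*sgn : ∀ x n → altSum x (2 ℕ.* n) n ≈ centralSum x n * sgn n
  altSum≈centralSum*sgn x n = begin
    sum0 f (2 ℕ.* n)
      ≡⟨ ≡.cong (λ m → sum0 f (n ℕ.+ m)) (ℕₚ.+-identityʳ n) ⟩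
    sum0 f (n ℕ.+ n)
      ≈⟨ sum0-fold f n ⟩
    f n + sum1 (λ k → f (n ℕ.∸ k) + f (n ℕ.+ k)) n
      ≈⟨ +-cong centre (sum1-cong n (λ k _ k≤n → altTerm-pair x k≤n)) ⟩
    qbinom x (2 ℕ.* n) n * sgn n + sum1 (λ k → centralTerm x n k * sgn n) n
      ≈⟨ +-congˡ (*-distribʳ-sum1 (sgn n) (centralTerm x n) n) ⟨
    qbinom x (2 ℕ.* n) n * sgn n + sum1 (centralTerm x n) n * sgn n
      ≈⟨ distribʳ _ _ _ ⟨
    centralSum x n * sgn n
      ∎
    where
      f = altTerm x (2 ℕ.* n) n
      centre : f n ≈ qbinom x (2 ℕ.* n) n * sgn n
      centre = begin
        sgn n * pow x (diffC2 n n) * qbinom x (2 ℕ.* n) n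
          ≈⟨ *-congʳ (*-congˡ (reflexive (≡.cong (pow x) (diffC2-diag n)))) ⟩
        sgn n * 1# * qbinom x (2 ℕ.* n) n                  ≈⟨ *-congʳ (*-identityʳ _) ⟩
        sgn n * qbinom x (2 ℕ.* n) n                       ≈⟨ *-comm _ _ ⟩
        qbinom x (2 ℕ.* n) n * sgn n                       ∎

  centralSum-vanishes : ∀ x m → centralSum x (suc m) ≈ 0#
  centralSum-vanishes x m = begin
    centralSum x n                          ≈⟨ *-identityʳ _ ⟨
    centralSum x n * 1#                     ≈⟨ *-congˡ (sgn-square n) ⟨
    centralSum x n * (sgn n * sgn n)        ≈⟨ *-assoc _ _ _ ⟨
    centralSum x n * sgn n * sgn n          ≈⟨ *-congʳ (altSum≈centralSum*sgn x n) ⟨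
    altSum x (2 ℕ.* n) n * sgn n            ≈⟨ *-congʳ (altSum-vanishes x (ℕₚ.m≤m+n m _)) ⟩
    0# * sgn n                              ≈⟨ zeroˡ _ ⟩
    0#                                      ∎
    where n = suc m

  divide-by-units : ∀ {a b u v w u′ v′ w′} → a * u ≈ b * (v * w) →
    u * u′ ≈ 1# → v * v′ ≈ 1# → w * w′ ≈ 1# → a * (v′ * w′) ≈ b * u′
  divide-by-units {a} {b} {u} {v} {w} {u′} {v′} {w′} au≈bvw uu′≈1 vv′≈1 ww′≈1 = begin
    a * (v′ * w′)                   ≈⟨ *-identityʳ _ ⟨
    a * (v′ * w′) * 1#              ≈⟨ *-congˡ uu′≈1 ⟨
    a * (v′ * w′) * (u * u′)
      ≈⟨ solve 5 (λ a u u′ v′ w′ → a :* (v′ :* w′) :* (u :* u′) := a :* u :* (v′ :* w′ :* u′))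
                 refl a u u′ v′ w′ ⟩
    a * u * (v′ * w′ * u′)          ≈⟨ *-congʳ au≈bvw ⟩
    b * (v * w) * (v′ * w′ * u′)
      ≈⟨ solve 6 (λ b u′ v v′ w w′ → b :* (v :* w) :* (v′ :* w′ :* u′) := b :* (v :* v′ :* (w :* w′)) :* u′)
                 refl b u′ v v′ w w′ ⟩
    b * (v * v′ * (w * w′)) * u′    ≈⟨ *-congʳ (*-congˡ (*-cong vv′≈1 ww′≈1)) ⟩
    b * (1# * 1#) * u′              ≈⟨ *-congʳ (trans (*-congˡ (*-identityˡ 1#)) (*-identityʳ b)) ⟩
    b * u′                          ∎

  module _ (q : Carrier) (inv : ℕ → Carrier) (N : ℕ)
           (inv-inverse : ∀ j → 1 ≤ j → j ≤ N → inv j * (1# + pow q j) ≈ 1#) where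

    negPoch*invNegPoch : ∀ {j} → j ≤ N → negPoch q j * invNegPoch inv j ≈ 1#
    negPoch*invNegPoch {zero}  _   = *-identityˡ 1#
    negPoch*invNegPoch {suc j} j<N = begin
      negPoch q j * (1# + pow q (suc j)) * (invNegPoch inv j * inv (suc j))
        ≈⟨ solve 4 (λ P p I i → P :* p :* (I :* i) := P :* I :* (i :* p))
                   refl (negPoch q j) (1# + pow q (suc j)) (invNegPoch inv j) (inv (suc j)) ⟩
      negPoch q j * invNegPoch inv j * (inv (suc j) * (1# + pow q (suc j)))
        ≈⟨ *-cong (negPoch*invNegPoch (ℕₚ.<⇒≤ j<N)) (inv-inverse (suc j) (s≤s z≤n) j<N) ⟩
      1# * 1#
        ≈⟨ *-identityʳ 1# ⟩
      1#
        ∎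

    qbinom*invNegPoch : ∀ {a b M} → a ℕ.+ b ≡ M → M ≤ N →
      qbinom q M a * (invNegPoch inv a * invNegPoch inv b) ≈ qbinom (q * q) M a * invNegPoch inv M
    qbinom*invNegPoch {a} {b} ≡.refl a+b≤N =
      divide-by-units (qbinom-negPoch q a b) (negPoch*invNegPoch a+b≤N)
        (negPoch*invNegPoch (ℕₚ.≤-trans (ℕₚ.m≤m+n a b) a+b≤N))
        (negPoch*invNegPoch (ℕₚ.≤-trans (ℕₚ.m≤n+m b a) a+b≤N))

    lhs-term≈centralTerm : ∀ {n k} → 2 ℕ.* n ≤ N → k ≤ n →
      sgn k * pow q (2 ℕ.* (k C 2)) * qbinom q (2 ℕ.* n) (n ℕ.∸ k) * (1# + pow q (2 ℕ.* k))
        * (invNegPoch inv (n ℕ.∸ k) * invNegPoch inv (n ℕ.+ k))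
        ≈ centralTerm (q * q) n k * invNegPoch inv (2 ℕ.* n)
    lhs-term≈centralTerm {n} {k} 2n≤N k≤n = begin
      sgn k * pow q (2 ℕ.* (k C 2)) * α * (1# + pow q (2 ℕ.* k)) * I
        ≈⟨ *-congʳ (*-cong (*-congʳ (*-congˡ (pow-2* q (k C 2)))) (+-congˡ (pow-2* q k))) ⟩
      sgn k * pow Q (k C 2) * α * (1# + pow Q k) * I
        ≈⟨ solve 5 (λ s e a o i → s :* e :* a :* o :* i := s :* e :* o :* (a :* i))
                   refl (sgn k) (pow Q (k C 2)) α (1# + pow Q k) I ⟩
      sgn k * pow Q (k C 2) * (1# + pow Q k) * (α * I)
        ≈⟨ *-congˡ (qbinom*invNegPoch ([n∸k]+[n+k]≡2n k≤n) 2n≤N) ⟩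
      sgn k * pow Q (k C 2) * (1# + pow Q k) * (β * I₂ₙ)
        ≈⟨ solve 5 (λ s e o b i → s :* e :* o :* (b :* i) := s :* e :* b :* o :* i)
                   refl (sgn k) (pow Q (k C 2)) (1# + pow Q k) β I₂ₙ ⟩
      centralTerm Q n k * I₂ₙ
        ∎
      where
        Q = q * q
        α = qbinom q (2 ℕ.* n) (n ℕ.∸ k)
        β = qbinom Q (2 ℕ.* n) (n ℕ.∸ k)
        I = invNegPoch inv (n ℕ.∸ k) * invNegPoch inv (n ℕ.+ k)
        I₂ₙ = invNegPoch inv (2 ℕ.* n)

    lhs≈centralSum*invNegPoch : ∀ n → 2 ℕ.* n ≤ N →
      lhs q inv n ≈ centralSum (q * q) n * invNegPoch inv (2 ℕ.* n)
    lhs≈centralSum*invNegPoch n 2n≤N = begin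
      lhs q inv n
        ≈⟨ +-cong (qbinom*invNegPoch n+n≡2n 2n≤N)
                  (sum1-cong n (λ k _ k≤n → lhs-term≈centralTerm 2n≤N k≤n)) ⟩
      qbinom Q (2 ℕ.* n) n * I₂ₙ + sum1 (λ k → centralTerm Q n k * I₂ₙ) n
        ≈⟨ +-congˡ (*-distribʳ-sum1 I₂ₙ (centralTerm Q n) n) ⟨
      qbinom Q (2 ℕ.* n) n * I₂ₙ + sum1 (centralTerm Q n) n * I₂ₙ
        ≈⟨ distribʳ _ _ _ ⟨
      centralSum Q n * I₂ₙ
        ∎
      where
        Q = q * q
        I₂ₙ = invNegPoch inv (2 ℕ.* n)
        n+n≡2n : n ℕ.+ n ≡ 2 ℕ.* n
        n+n≡2n = ≡.cong (n ℕ.+_) (≡.sym (ℕₚ.+-identityʳ n))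

-- Brought into scope only here: in the ring development above, _*_ is the ring multiplication.
open import Data.Nat using (_*_)

mainTheorem13 : ∀ {c ℓ : Level} (R : CommutativeRing c ℓ) (n : ℕ)
    (q : CommutativeRing.Carrier R) (inv : ℕ → CommutativeRing.Carrier R) →
    (∀ j → 1 ≤ j → j ≤ 2 * n →
      CommutativeRing._≈_ R (CommutativeRing._*_ R (inv j) (CommutativeRing._+_ R (CommutativeRing.1# R) (QSeries.pow R q j))) (CommutativeRing.1# R)) →
    CommutativeRing._≈_ R (QSeries.lhs R q inv n) (QSeries.isZero R n)
mainTheorem13 R zero    q inv _           = trans (+-identityʳ _) (trans (*-identityˡ _) (*-identityˡ 1#))
  where open CommutativeRing R using (1#; trans; +-identityʳ; *-identityˡ)
mainTheorem13 R (suc m) q inv inv-inverse =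
  trans (lhs≈centralSum*invNegPoch R q inv (2 * suc m) inv-inverse (suc m) ℕₚ.≤-refl)
        (trans (*-congʳ (centralSum-vanishes R _ m)) (zeroˡ _))
  where open CommutativeRing R using (trans; *-congʳ; zeroˡ)
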